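{- For any graph $G$ on $n$ vertices and any $\alpha\in(0,1]$, $\mathrm{pd}_\alpha(G)+\mathrm{pd}_\alpha(\overline{G})\le \left\lceil \dfrac{n}{\lfloor 1/\alpha\rfloor}\right\rceil+1$, where $\overline{G}$ is the complement of $G$.
   Context: All graphs are finite and simple. For a graph $G=(V,E)$ and $S\subseteq V$, $N[S]$ denotes the closed neighbourhood of $S$. For $0<\alpha\le 1$, a set $S\subseteq V$ is an $\alpha$-partial dominating set if $|N[S]|\ge \alpha|V|$; $\mathrm{pd}_\alpha(G)$ is the minimum size of an $\alpha$-partial dominating set.
   Formalization: The parameter α ranges over the rationals in $(0,1]$. -}

module Defs where

open import Data.Nat using (ℕ; zero; suc; _+_; _*_; _∸_; _≤_; _<_; NonZero)
open import Data.Nat.DivMod using (_/_)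
open import Data.Bool using (Bool; true; false; not; T)
open import Data.Fin using (Fin)
open import Data.Fin.Subset using (Subset; _∈_; ∣_∣)
open import Data.Vec using (tabulate)
open import Data.Bool.ListAction using (any)
open import Data.List.Base using (allFin)
open import Data.Vec using (lookup)
open import Data.Product using (_×_; Σ)
open import Relation.Binary.PropositionalEquality using (_≡_)
open import Relation.Nullary using (¬_)

record Graph (n : ℕ) : Set where
  field
    adj     : Fin n → Fin n → Bool
    sym     : ∀ u v → adj u v ≡ adj v u
    irrefl  : ∀ v → adj v v ≡ false

open Graph public

module _ {n : ℕ} where
  open import Data.Fin using (_≟_)
  open import Relation.Nullary using (yes; no)
  open import Relation.Binary.PropositionalEquality using (refl; sym; cong)

  cadj : Graph n → Fin n → Fin n → Bool
  cadj G u v with u ≟ v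
  ... | yes _ = false
  ... | no  _ = not (adj G u v)

  cadj-sym : (G : Graph n) → ∀ u v → cadj G u v ≡ cadj G v u
  cadj-sym G u v with u ≟ v | v ≟ u
  ... | yes _ | yes _ = refl
  ... | yes refl | no ne = Data.Empty.⊥-elim (ne refl) where import Data.Empty
  ... | no ne | yes refl = Data.Empty.⊥-elim (ne refl) where import Data.Empty
  ... | no _ | no _ = cong not (Graph.sym G u v)

  cadj-irrefl : (G : Graph n) → ∀ v → cadj G v v ≡ false
  cadj-irrefl G v with v ≟ v
  ... | yes _ = refl
  ... | no ne = Data.Empty.⊥-elim (ne refl) where import Data.Empty

complement : {n : ℕ} → Graph n → Graph n
complement G = record { adj = cadj G ; sym = cadj-sym G ; irrefl = cadj-irrefl G }

closedNbhd : {n : ℕ} → Graph n → Subset n → Subset n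
closedNbhd {n} G S =
  tabulate λ v → lookup S v Data.Bool.∨ any (λ u → lookup S u Data.Bool.∧ adj G u v) (allFin n)
  where import Data.Bool

-- α = p / q with 0 < p ≤ q (a rational in (0,1]).
-- S is an α-partial dominating set iff |N[S]| ≥ α·n, i.e. q·|N[S]| ≥ p·n.
IsPartialDom : {n : ℕ} → Graph n → (p q : ℕ) → Subset n → Set
IsPartialDom {n} G p q S = p * n ≤ q * ∣ closedNbhd G S ∣

IsPdNumber : {n : ℕ} → Graph n → (p q : ℕ) → ℕ → Set
IsPdNumber {n} G p q k =
  Σ (Subset n) (λ S → IsPartialDom G p q S × ∣ S ∣ ≡ k)
  × (∀ (S : Subset n) → IsPartialDom G p q S → k ≤ ∣ S ∣)

-- floor (q / p) for p > 0 (this is ⌊1/α⌋ for α = p/q).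
floorDiv : ℕ → ℕ → ℕ
floorDiv q zero = zero
floorDiv q (suc p) = q / suc p

ceilDiv : ℕ → ℕ → ℕ
ceilDiv n zero = zero
ceilDiv n (suc m) = (n + m) / suc m

-- Let m = ⌊q/p⌋ = ⌊1/α⌋ and t = ⌈n/m⌉; then α·n ≤ t. So for any set U of min(n, t)
-- vertices, every set whose closed neighbourhood contains U is α-partially
-- dominating. Fix v ∈ U with G-neighbourhood A. In G, U ─ A is such a set, since
-- v ∈ U ─ A covers A; in the complement, ⁅ v ⁆ ∪ (U ∩ A) is one, since there v is
-- adjacent to every other vertex outside A. The two sets have at most |U| + 1
-- elements together.

{-# OPTIONS --safe #-}
module Submission where

open import Defs hiding (sym)
open import Data.Nat using (ℕ; zero; suc; _+_; _*_; _⊓_; _≤_; _<_; z≤n; s≤s; s≤s⁻¹)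
open import Data.Nat.Properties
  using ( ≤-trans; ≤-reflexive; +-suc; +-comm; +-mono-≤; +-monoˡ-≤; +-monoʳ-≤; +-cancelʳ-≤
        ; *-comm; *-assoc; *-monoˡ-≤; *-monoʳ-≤; m≤n+m; ⊓-glb; m⊓n≤n; *-distribˡ-⊓; module ≤-Reasoning)
open import Data.Nat.DivMod using (_%_; m≡m%n+[m/n]*n; m%n<n; m/n*n≤m; m≥n⇒m/n>0)
open import Data.Bool using (Bool; true; false; not; T; _∧_)
open import Data.Bool.Properties using (T-≡; T-∨)
open import Data.Fin using (Fin; _≟_) renaming (zero to fzero)
open import Data.Fin.Subset using (Subset; inside; outside; ⊥; ⊤; ⁅_⁆; _∪_; _∩_; _─_; ∣_∣; _∈_; _∉_; _⊆_)
open import Data.Fin.Subset.Properties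
  using ( ∣p∣≤n; ∣p∣≤∣x∷p∣; ∣⊥∣≡0; ∣⊤∣≡n; ∣⁅x⁆∣≡1; p⊆q⇒∣p∣≤∣q∣
        ; x∈⁅x⁆; x∈p∪q⁺; x∈p∩q⁺; x∈p∧x∉q⇒x∈p─q)
open import Data.Vec using ([]; _∷_; tabulate; lookup; here)
open import Data.Vec.Properties using (lookup∘tabulate; []=⇒lookup; lookup⇒[]=)
open import Data.List.Membership.Propositional using (lose)
open import Data.List.Membership.Propositional.Properties using (∈-allFin)
open import Data.List.Relation.Unary.Any.Properties using (any⁺)
open import Data.Product using (_,_)
open import Data.Sum using (inj₁; inj₂)
open import Function.Bundles using (Equivalence)
open import Relation.Binary.PropositionalEquality using (_≡_; _≢_; refl; sym; trans; cong; cong₂)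
open import Relation.Nullary using (yes; no; contradiction)

open Equivalence using (to; from)

private
  variable
    n p q k₁ k₂ : ℕ

∣p∪q∣≤∣p∣+∣q∣ : ∀ (p q : Subset n) → ∣ p ∪ q ∣ ≤ ∣ p ∣ + ∣ q ∣
∣p∪q∣≤∣p∣+∣q∣ []            []            = z≤n
∣p∪q∣≤∣p∣+∣q∣ (outside ∷ p) (outside ∷ q) = ∣p∪q∣≤∣p∣+∣q∣ p q
∣p∪q∣≤∣p∣+∣q∣ (outside ∷ p) (inside  ∷ q) =
  ≤-trans (s≤s (∣p∪q∣≤∣p∣+∣q∣ p q)) (≤-reflexive (sym (+-suc ∣ p ∣ ∣ q ∣)))
∣p∪q∣≤∣p∣+∣q∣ (inside  ∷ p) (s ∷ q) =
  s≤s (≤-trans (∣p∪q∣≤∣p∣+∣q∣ p q) (+-monoʳ-≤ ∣ p ∣ (∣p∣≤∣x∷p∣ s q)))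

∣p─q∣+∣p∩q∣≡∣p∣ : ∀ (p q : Subset n) → ∣ p ─ q ∣ + ∣ p ∩ q ∣ ≡ ∣ p ∣
∣p─q∣+∣p∩q∣≡∣p∣ []            []            = refl
∣p─q∣+∣p∩q∣≡∣p∣ (outside ∷ p) (outside ∷ q) = ∣p─q∣+∣p∩q∣≡∣p∣ p q
∣p─q∣+∣p∩q∣≡∣p∣ (outside ∷ p) (inside  ∷ q) = ∣p─q∣+∣p∩q∣≡∣p∣ p q
∣p─q∣+∣p∩q∣≡∣p∣ (inside  ∷ p) (outside ∷ q) = cong suc (∣p─q∣+∣p∩q∣≡∣p∣ p q)
∣p─q∣+∣p∩q∣≡∣p∣ (inside  ∷ p) (inside  ∷ q) =
  trans (+-suc ∣ p ─ q ∣ ∣ p ∩ q ∣) (cong suc (∣p─q∣+∣p∩q∣≡∣p∣ p q))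

∈-tabulate⁺ : ∀ {f : Fin n → Bool} {x} → f x ≡ true → x ∈ tabulate f
∈-tabulate⁺ {f = f} {x} fx≡true = lookup⇒[]= x (tabulate f) (trans (lookup∘tabulate f x) fx≡true)

∈-tabulate⁻ : ∀ {f : Fin n → Bool} {x} → x ∈ tabulate f → f x ≡ true
∈-tabulate⁻ {f = f} {x} x∈ = trans (sym (lookup∘tabulate f x)) ([]=⇒lookup x∈)

∉-tabulate⁺ : ∀ {f : Fin n → Bool} {x} → f x ≡ false → x ∉ tabulate f
∉-tabulate⁺ fx≡false x∈ with () ← trans (sym fx≡false) (∈-tabulate⁻ x∈)

firstElements : ℕ → Subset n
firstElements {zero}  _       = []
firstElements {suc n} zero    = ⊥
firstElements {suc n} (suc t) = inside ∷ firstElements t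

∣firstElements∣≡n⊓t : ∀ n t → ∣ firstElements {n} t ∣ ≡ n ⊓ t
∣firstElements∣≡n⊓t zero    _       = refl
∣firstElements∣≡n⊓t (suc n) zero    = ∣⊥∣≡0 (suc n)
∣firstElements∣≡n⊓t (suc n) (suc t) = cong suc (∣firstElements∣≡n⊓t n t)

zero∈firstElements : ∀ {t} → 0 < t → fzero ∈ firstElements {suc n} t
zero∈firstElements {t = suc t} _ = here

S⊆closedNbhd : ∀ (G : Graph n) {S} → S ⊆ closedNbhd G S
S⊆closedNbhd G v∈S = ∈-tabulate⁺ (T-≡ .to (T-∨ .from (inj₁ (T-≡ .from ([]=⇒lookup v∈S)))))

adj⇒∈closedNbhd : ∀ (G : Graph n) {S u v} → u ∈ S → adj G u v ≡ true → v ∈ closedNbhd G S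
adj⇒∈closedNbhd G {S} {u} {v} u∈S uv =
  ∈-tabulate⁺ (T-≡ .to (T-∨ .from (inj₂ (any⁺ _ (lose (∈-allFin u) u-witness)))))
  where
  u-witness : T (lookup S u ∧ adj G u v)
  u-witness = T-≡ .from (cong₂ _∧_ ([]=⇒lookup u∈S) uv)

isPartialDom-⊆ : ∀ (G : Graph n) p q {U} S →
  p * n ≤ q * ∣ U ∣ → U ⊆ closedNbhd G S → IsPartialDom G p q S
isPartialDom-⊆ G p q S αn≤q∣U∣ U⊆N[S] = ≤-trans αn≤q∣U∣ (*-monoʳ-≤ q (p⊆q⇒∣p∣≤∣q∣ U⊆N[S]))

pdNumber≤n : ∀ (G : Graph n) {k} → p ≤ q → IsPdNumber G p q k → k ≤ n
pdNumber≤n {n} {p} {q} G p≤q (_ , minimal) = ≤-trans (minimal ⊤ ⊤-partialDom) (∣p∣≤n ⊤)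
  where
  αn≤q∣⊤∣ : p * n ≤ q * ∣ ⊤ {n} ∣
  αn≤q∣⊤∣ = ≤-trans (*-monoˡ-≤ n p≤q) (≤-reflexive (cong (q *_) (sym (∣⊤∣≡n n))))
  ⊤-partialDom : IsPartialDom G p q ⊤
  ⊤-partialDom = isPartialDom-⊆ G p q {⊤} ⊤ αn≤q∣⊤∣ (S⊆closedNbhd G)

module _ {n} (G : Graph n) where

  neighbours : Fin n → Subset n
  neighbours v = tabulate (adj G v)

  v∉neighbours : ∀ v → v ∉ neighbours v
  v∉neighbours v = ∉-tabulate⁺ (irrefl G v)

  adj-complement : ∀ {u v} → u ≢ v → adj G u v ≡ false → adj (complement G) u v ≡ true
  adj-complement {u} {v} u≢v uv with u ≟ v
  ... | yes u≡v = contradiction u≡v u≢v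
  ... | no  _   = cong not uv

  ⊆closedNbhd[U─neighbours] : ∀ {U v} → v ∈ U → U ⊆ closedNbhd G (U ─ neighbours v)
  ⊆closedNbhd[U─neighbours] {U} {v} v∈U {x} x∈U with adj G v x in vx
  ... | true  = adj⇒∈closedNbhd G (x∈p∧x∉q⇒x∈p─q v∈U (v∉neighbours v)) vx
  ... | false = S⊆closedNbhd G (x∈p∧x∉q⇒x∈p─q x∈U (∉-tabulate⁺ vx))

  ⊆closedNbhdᶜ[⁅v⁆∪U∩neighbours] : ∀ {U v} → v ∈ U →
    U ⊆ closedNbhd (complement G) (⁅ v ⁆ ∪ U ∩ neighbours v)
  ⊆closedNbhdᶜ[⁅v⁆∪U∩neighbours] {U} {v} v∈U {x} x∈U with v ≟ x | adj G v x in vx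
  ... | yes refl | _     = S⊆closedNbhd (complement G) (x∈p∪q⁺ (inj₁ (x∈⁅x⁆ x)))
  ... | no  _    | true  =
    S⊆closedNbhd (complement G) (x∈p∪q⁺ {p = ⁅ v ⁆} (inj₂ (x∈p∩q⁺ (x∈U , ∈-tabulate⁺ vx))))
  ... | no  v≢x  | false =
    adj⇒∈closedNbhd (complement G) (x∈p∪q⁺ (inj₁ (x∈⁅x⁆ v))) (adj-complement v≢x vx)

  pdNumber+pdNumberᶜ≤∣U∣+1 : ∀ p q {U v} → v ∈ U → p * n ≤ q * ∣ U ∣ →
    IsPdNumber G p q k₁ → IsPdNumber (complement G) p q k₂ → k₁ + k₂ ≤ ∣ U ∣ + 1
  pdNumber+pdNumberᶜ≤∣U∣+1 {k₁ = k₁} {k₂ = k₂} p q {U} {v} v∈U αn≤q∣U∣ (_ , minimal₁) (_ , minimal₂) = begin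
    k₁ + k₂                          ≤⟨ +-mono-≤ (minimal₁ S₁ S₁-partialDom) (minimal₂ S₂ S₂-partialDom) ⟩
    ∣ S₁ ∣ + ∣ S₂ ∣                  ≤⟨ +-monoʳ-≤ ∣ S₁ ∣ (∣p∪q∣≤∣p∣+∣q∣ ⁅ v ⁆ (U ∩ A)) ⟩
    ∣ S₁ ∣ + (∣ ⁅ v ⁆ ∣ + ∣ U ∩ A ∣) ≡⟨ cong (λ m → ∣ S₁ ∣ + (m + ∣ U ∩ A ∣)) (∣⁅x⁆∣≡1 v) ⟩
    ∣ S₁ ∣ + suc ∣ U ∩ A ∣           ≡⟨ +-suc ∣ S₁ ∣ ∣ U ∩ A ∣ ⟩
    suc (∣ S₁ ∣ + ∣ U ∩ A ∣)         ≡⟨ cong suc (∣p─q∣+∣p∩q∣≡∣p∣ U A) ⟩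
    suc ∣ U ∣                        ≡⟨ +-comm 1 ∣ U ∣ ⟩
    ∣ U ∣ + 1                        ∎
    where
    open ≤-Reasoning
    A S₁ S₂ : Subset n
    A  = neighbours v
    S₁ = U ─ A
    S₂ = ⁅ v ⁆ ∪ U ∩ A
    S₁-partialDom : IsPartialDom G p q S₁
    S₁-partialDom = isPartialDom-⊆ G p q S₁ αn≤q∣U∣ (⊆closedNbhd[U─neighbours] v∈U)
    S₂-partialDom : IsPartialDom (complement G) p q S₂
    S₂-partialDom = isPartialDom-⊆ (complement G) p q S₂ αn≤q∣U∣ (⊆closedNbhdᶜ[⁅v⁆∪U∩neighbours] v∈U)

floorDiv*≤ : ∀ q p → floorDiv q p * p ≤ q
floorDiv*≤ q zero    = z≤n
floorDiv*≤ q (suc p) = m/n*n≤m q (suc p)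

0<floorDiv : 0 < p → p ≤ q → 0 < floorDiv q p
0<floorDiv {suc p} _ p≤q = m≥n⇒m/n>0 p≤q

≤ceilDiv* : ∀ n m → 0 < m → n ≤ ceilDiv n m * m
≤ceilDiv* n (suc m) _ = +-cancelʳ-≤ m n (ceilDiv n (suc m) * suc m) (begin
  n + m                                        ≡⟨ m≡m%n+[m/n]*n (n + m) (suc m) ⟩
  (n + m) % suc m + ceilDiv n (suc m) * suc m  ≤⟨ +-monoˡ-≤ _ (s≤s⁻¹ (m%n<n (n + m) (suc m))) ⟩
  m + ceilDiv n (suc m) * suc m                ≡⟨ +-comm m _ ⟩
  ceilDiv n (suc m) * suc m + m                ∎)
  where open ≤-Reasoning

0<ceilDiv : ∀ {n m} → 0 < n → 0 < m → 0 < ceilDiv n m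
0<ceilDiv {suc n} {suc m} _ _ = m≥n⇒m/n>0 (s≤s (m≤n+m m n))

p*n≤q*⌈n/⌊q/p⌋⌉ : 0 < p → p ≤ q → p * n ≤ q * ceilDiv n (floorDiv q p)
p*n≤q*⌈n/⌊q/p⌋⌉ {p} {q} {n} 0<p p≤q = begin
  p * n        ≤⟨ *-monoʳ-≤ p (≤ceilDiv* n m (0<floorDiv 0<p p≤q)) ⟩
  p * (t * m)  ≡⟨ *-comm p (t * m) ⟩
  t * m * p    ≡⟨ *-assoc t m p ⟩
  t * (m * p)  ≤⟨ *-monoʳ-≤ t (floorDiv*≤ q p) ⟩
  t * q        ≡⟨ *-comm t q ⟩
  q * t        ∎
  where
  open ≤-Reasoning
  m t : ℕ
  m = floorDiv q p
  t = ceilDiv n m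

mainTheorem14 : (n : ℕ) (G : Graph n) (p q : ℕ) → 0 < p → p ≤ q →
    (k₁ k₂ : ℕ) → IsPdNumber G p q k₁ → IsPdNumber (complement G) p q k₂ →
    k₁ + k₂ ≤ ceilDiv n (floorDiv q p) + 1
mainTheorem14 zero G p q _ p≤q k₁ k₂ pd₁ pd₂ =
  ≤-trans (+-mono-≤ (pdNumber≤n G p≤q pd₁) (pdNumber≤n (complement G) p≤q pd₂)) z≤n
mainTheorem14 (suc n) G p q 0<p p≤q k₁ k₂ pd₁ pd₂ = begin
  k₁ + k₂        ≤⟨ pdNumber+pdNumberᶜ≤∣U∣+1 G p q (zero∈firstElements 0<t) αn≤q∣U∣ pd₁ pd₂ ⟩
  ∣ U ∣ + 1      ≡⟨ cong (_+ 1) (∣firstElements∣≡n⊓t (suc n) t) ⟩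
  suc n ⊓ t + 1  ≤⟨ +-monoˡ-≤ 1 (m⊓n≤n (suc n) t) ⟩
  t + 1          ∎
  where
  open ≤-Reasoning
  t : ℕ
  t = ceilDiv (suc n) (floorDiv q p)
  U : Subset (suc n)
  U = firstElements t
  0<t : 0 < t
  0<t = 0<ceilDiv (s≤s z≤n) (0<floorDiv 0<p p≤q)
  αn≤q∣U∣ : p * suc n ≤ q * ∣ U ∣
  αn≤q∣U∣ = begin
    p * suc n              ≤⟨ ⊓-glb (*-monoˡ-≤ (suc n) p≤q) (p*n≤q*⌈n/⌊q/p⌋⌉ 0<p p≤q) ⟩
    (q * suc n) ⊓ (q * t)  ≡⟨ *-distribˡ-⊓ q (suc n) t ⟨
    q * (suc n ⊓ t)        ≡⟨ cong (q *_) (∣firstElements∣≡n⊓t (suc n) t) ⟨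
    q * ∣ U ∣              ∎
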